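{- Let $n\ge 3$, let $G$ be a bipartite graph and $H$ a non-bipartite graph, both on $n$ vertices. Suppose there are $m\ge \frac{5n}{6}+2$ distinct vertices $v_1,\dots,v_m$ of $G$ and distinct vertices $w_1,\dots,w_m$ of $H$ with $G-v_i\cong H-w_i$ for all $i$. Then at least $\frac{2n}{3}+4$ of the vertices $w_1,\dots,w_m$ have degree $2$ in $H$.
   Context: All graphs are finite and simple. For a graph $X$ and vertex $v$, $X-v$ denotes the graph obtained by deleting $v$ and its incident edges. -}

module Defs where

open import Data.Nat using (ℕ; zero; suc; _+_)
open import Data.Bool using (Bool; true; false; not)
open import Data.Fin using (Fin; punchIn)
open import Data.Product using (Σ; ∃; _×_)
open import Data.List using (List; length; filter)
open import Data.Fin using () renaming (zero to fz)
open import Data.List using () 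
open import Data.Fin.Base using ()
open import Data.Vec.Functional using ()
open import Data.List.Base using (allFin)
open import Relation.Binary.PropositionalEquality using (_≡_; _≢_)
open import Relation.Nullary.Decidable using (Dec)
open import Data.Bool using (T)
open import Function.Bundles using (_↔_; Inverse)

record Graph (n : ℕ) : Set where
  field
    adj   : Fin n → Fin n → Bool
    sym   : ∀ x y → adj x y ≡ adj y x
    irrefl : ∀ x → adj x x ≡ false
open Graph public

-- X - v : delete vertex v; remaining vertices are re-indexed by Fin n
-- via punchIn v (an order-preserving bijection Fin n ≅ Fin (suc n) ∖ {v}).
delete : ∀ {n} → Graph (suc n) → Fin (suc n) → Graph n
delete X v = record
  { adj = λ x y → adj X (punchIn v x) (punchIn v y)
  ; sym = λ x y → sym X (punchIn v x) (punchIn v y)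
  ; irrefl = λ x → irrefl X (punchIn v x)
  }

_≅_ : ∀ {n} → Graph n → Graph n → Set
_≅_ {n} X Y = Σ (Fin n ↔ Fin n) λ f →
  ∀ x y → adj X x y ≡ adj Y (Inverse.to f x) (Inverse.to f y)

Bipartite : ∀ {n} → Graph n → Set
Bipartite {n} X = Σ (Fin n → Bool) λ c →
  ∀ x y → adj X x y ≡ true → c x ≢ c y

degree : ∀ {n} → Graph n → Fin n → ℕ
degree {n} X v = length (filter (λ u → Data.Bool._≟_ (adj X v u) true) (allFin n))

{-# OPTIONS --safe #-}
module Submission where

-- Let C be a shortest odd closed walk of H (it exists classically, which suffices because the
-- conclusion is decidable) and k its length. Each H − w_i is bipartite, so w_i lies on every odd
-- closed walk, in particular on C. By minimality every vertex of C has exactly two neighbours on C,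
-- so a w_i of degree ≠ 2 has a neighbour x_i off C. Send such a w_i to x_i, unless an earlier such
-- w_j has x_j = x_i: then w_i and w_j are at distance two along C (minimality again) and w_i is sent
-- to the vertex y between them. No w_l equals y, because the closed walk w_i x_i w_j ⋯ w_i of odd
-- length k avoids y, and y has only two neighbours on C; so this map is injective and misses all w_l.
-- Hence m + #{i : deg w_i ≠ 2} ≤ n, and the bound follows from 6m ≥ 5n + 12.

open import Defs
open import Data.Nat using (ℕ; zero; suc; _+_; _*_; _≤_; _<_; _≟_; _≤?_; z≤n; s≤s; s≤s⁻¹)
open import Data.Fin as Fin using (Fin; zero; suc; punchIn; punchOut)
open import Data.List using (List; []; _∷_; _++_; length; filter; map; lookup)
open import Data.List.Base using (allFin)
open import Function.Definitions using (Injective)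
open import Relation.Binary.PropositionalEquality as ≡ using (_≡_; _≢_; refl; trans; cong; subst)
open import Relation.Nullary using (¬_; Dec; yes; no; ¬?; contradiction)

open import Data.Bool using (Bool; true; false; not; _xor_)
import Data.Bool as Bool
open import Data.Bool.Properties
  using (not-involutive; not-distribˡ-xor; not-distribʳ-xor; xor-identityʳ; xor-comm; xor-same; ¬-not; not-¬)
open import Data.Empty using (⊥; ⊥-elim)
open import Data.Fin.Induction using () renaming (<-wellFounded to <ᶠ-wellFounded)
open import Data.Fin.Properties as Finₚ using (any?; pigeonhole; punchIn-punchOut; punchOut-cong)
open import Data.List.Properties using (length-map; length-++; length-tabulate)
open import Data.List.Membership.Propositional using (_∈_)
open import Data.List.Membership.Propositional.Properties
  using (∈-lookup; ∈-filter⁺; ∈-filter⁻; ∈-allFin; ∈-map⁻)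
open import Data.List.Relation.Unary.All using (All; []; _∷_)
open import Data.List.Relation.Unary.Any using (here; there)
open import Data.List.Relation.Unary.Unique.Propositional using (Unique; []; _∷_)
open import Data.List.Relation.Unary.Unique.Propositional.Properties
  using (Unique[x∷xs]⇒x∉xs; filter⁺; allFin⁺; map⁺; ++⁺)
open import Data.Nat.Induction using (<-wellFounded)
open import Data.Nat.Properties
  using (+-comm; +-suc; m<m+n; m<n+m; m≤n+m; ≤⇒≯; <⇒≱; ≮⇒≥; ≰⇒>; +-monoʳ-<; +-monoˡ-<;
         +-monoʳ-≤; *-monoʳ-≤; +-cancelʳ-≤; module ≤-Reasoning)
open import Data.Nat.Solver using (module +-*-Solver)
open import Data.Product using (Σ; ∃; ∃₂; _×_; _,_; proj₁; proj₂)
open import Data.Sum using (_⊎_; inj₁; inj₂; [_,_]′; map₁)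
open import Function using (_∘_)
open import Function.Bundles using (Inverse)
open import Induction.WellFounded using (WellFounded; Acc; acc)
open import Relation.Binary using (Rel; tri<; tri≈; tri>)
import Relation.Binary.Construct.On as On
open import Relation.Nullary.Decidable using (_×-dec_; _⊎-dec_; decidable-stable; ¬¬-excluded-middle)
open import Relation.Unary using (Pred; Decidable)
open import Relation.Unary.Properties using (∁?)

odd : ℕ → Bool
odd zero    = false
odd (suc n) = not (odd n)

odd-+ : ∀ a b → odd (a + b) ≡ odd a xor odd b
odd-+ zero    b = refl
odd-+ (suc a) b = trans (cong not (odd-+ a b)) (not-distribˡ-xor (odd a) (odd b))

odd-2+ : ∀ n → odd (2 + n) ≡ odd n
odd-2+ n = not-involutive (odd n)

odd-+⇒odd⊎odd : ∀ a b → odd (a + b) ≡ true → odd a ≡ true ⊎ odd b ≡ true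
odd-+⇒odd⊎odd a b odd-sum with odd a | odd-+ a b
... | true  | _  = inj₁ refl
... | false | eq = inj₂ (trans (≡.sym eq) odd-sum)

¬¬-∀-Fin : ∀ {n p} {P : Fin n → Set p} → (∀ i → ¬ ¬ P i) → ¬ ¬ (∀ i → P i)
¬¬-∀-Fin {zero}  _ k = k λ ()
¬¬-∀-Fin {suc n} h k =
  h zero λ p₀ → ¬¬-∀-Fin (h ∘ suc) λ p₊ → k λ { zero → p₀ ; (suc i) → p₊ i }

module _ {a r p} {A : Set a} {_<_ : Rel A r} (wf : WellFounded _<_) {P : Pred A p} where

  ¬¬-minimal : ∀ {x} → P x → ¬ ¬ (Σ A λ y → P y × ∀ {z} → P z → ¬ z < y)
  ¬¬-minimal {x} = go (wf x)
    where
      go : ∀ {x} → Acc _<_ x → P x → ¬ ¬ (Σ A λ y → P y × ∀ {z} → P z → ¬ z < y)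
      go {x} (acc smaller) px k = ¬¬-excluded-middle {A = ∃ λ z → P z × z < x} λ
        { (yes (z , pz , z<x)) → go (smaller z<x) pz k
        ; (no none)            → k (x , px , λ pz z<x → none (_ , pz , z<x)) }

module _ {a p} {A : Set a} {P : Pred A p} (P? : Decidable P) where

  length-filter+length-filter-∁ : ∀ xs → length (filter P? xs) + length (filter (∁? P?) xs) ≡ length xs
  length-filter+length-filter-∁ []       = refl
  length-filter+length-filter-∁ (x ∷ xs) with P? x
  ... | yes _ = cong suc (length-filter+length-filter-∁ xs)
  ... | no  _ = trans (+-suc _ _) (cong suc (length-filter+length-filter-∁ xs))

module _ {a} {A : Set a} where

  Unique⇒lookup-≢ : ∀ {xs : List A} → Unique xs → ∀ {i j} → i Fin.< j → lookup xs i ≢ lookup xs j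
  Unique⇒lookup-≢ {_ ∷ xs} u {zero} {suc j} _ eq =
    Unique[x∷xs]⇒x∉xs u (subst (_∈ xs) (≡.sym eq) (∈-lookup j))
  Unique⇒lookup-≢ (_ ∷ u) {suc i} {suc j} (s≤s i<j) = Unique⇒lookup-≢ u i<j

  Unique⊆pair⇒length≡2 : ∀ {xs : List A} {s t} → Unique xs → (∀ {z} → z ∈ xs → z ≡ s ⊎ z ≡ t) →
                          s ∈ xs → t ∈ xs → s ≢ t → length xs ≡ 2
  Unique⊆pair⇒length≡2 {[]} _ _ () _ _
  Unique⊆pair⇒length≡2 {_ ∷ []} _ _ (here refl) (here refl) s≢t = ⊥-elim (s≢t refl)
  Unique⊆pair⇒length≡2 {_ ∷ _ ∷ []} _ _ _ _ _ = refl
  Unique⊆pair⇒length≡2 {a ∷ b ∷ c ∷ _} ((a≢b ∷ a≢c ∷ _) ∷ (b≢c ∷ _) ∷ _) ⊆st _ _ _ =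
    ⊥-elim (three-in-two (⊆st (here refl)) (⊆st (there (here refl))) (⊆st (there (there (here refl)))))
    where
      three-in-two : ∀ {s t} → a ≡ s ⊎ a ≡ t → b ≡ s ⊎ b ≡ t → c ≡ s ⊎ c ≡ t → ⊥
      three-in-two (inj₁ p) (inj₁ q) _        = ⊥-elim (a≢b (trans p (≡.sym q)))
      three-in-two (inj₂ p) (inj₂ q) _        = ⊥-elim (a≢b (trans p (≡.sym q)))
      three-in-two (inj₁ p) (inj₂ q) (inj₁ r) = ⊥-elim (a≢c (trans p (≡.sym r)))
      three-in-two (inj₁ p) (inj₂ q) (inj₂ r) = ⊥-elim (b≢c (trans q (≡.sym r)))
      three-in-two (inj₂ p) (inj₁ q) (inj₁ r) = ⊥-elim (b≢c (trans q (≡.sym r)))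
      three-in-two (inj₂ p) (inj₁ q) (inj₂ r) = ⊥-elim (a≢c (trans p (≡.sym r)))

  map⁺-injectiveOn : ∀ {b} {B : Set b} {f : A → B} {xs} → Unique xs →
                     (∀ {x y} → x ∈ xs → y ∈ xs → f x ≡ f y → x ≡ y) → Unique (map f xs)
  map⁺-injectiveOn {xs = []}     []       _   = []
  map⁺-injectiveOn {f = f} {xs = x ∷ xs} (x∉ ∷ u) inj =
    images x∉ there ∷ map⁺-injectiveOn u (λ p q → inj (there p) (there q))
    where
      images : ∀ {ys} → All (x ≢_) ys → (∀ {y} → y ∈ ys → y ∈ x ∷ xs) → All (f x ≢_) (map f ys)
      images []         _  = []
      images (x≢y ∷ ns) ⊆ = (x≢y ∘ inj (here refl) (⊆ (here refl))) ∷ images ns (⊆ ∘ there)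

Unique⇒length≤ : ∀ {N} {xs : List (Fin N)} → Unique xs → length xs ≤ N
Unique⇒length≤ {N} {xs} u with length xs ≤? N
... | yes ≤N = ≤N
... | no  ≰N with pigeonhole (≰⇒> ≰N) (lookup xs)
...   | _ , _ , i<j , same = ⊥-elim (Unique⇒lookup-≢ u i<j same)

ProperOff : ∀ {N} → Graph N → (Fin N → Bool) → Fin N → Set
ProperOff X c u = ∀ {x y} → x ≢ u → y ≢ u → adj X x y ≡ true → c x ≢ c y

delete-bipartite : ∀ {n} {X : Graph (suc n)} → Bipartite X → ∀ v → Bipartite (delete X v)
delete-bipartite (c , proper) v = c ∘ punchIn v , λ x y → proper (punchIn v x) (punchIn v y)

≅-bipartite : ∀ {n} {X Y : Graph n} → X ≅ Y → Bipartite X → Bipartite Y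
≅-bipartite {X = X} {Y} (f , preserves) (c , proper) =
  c ∘ from , λ x y → proper (from x) (from y) ∘ reflect x y
  where
    open Inverse f using (from; strictlyInverseˡ)
    reflect : ∀ x y → adj Y x y ≡ true → adj X (from x) (from y) ≡ true
    reflect x y x~y = trans (preserves (from x) (from y))
                            (trans (≡.cong₂ (adj Y) (strictlyInverseˡ x) (strictlyInverseˡ y)) x~y)

bipartite-delete⇒properOff : ∀ {n} {X : Graph (suc n)} {v} → Bipartite (delete X v) →
                             Σ (Fin (suc n) → Bool) λ c → ProperOff X c v
bipartite-delete⇒properOff {n} {X} {v} (c , proper) = c′ , proper′
  where
    c′ : Fin (suc n) → Bool
    c′ x with v Fin.≟ x
    ... | yes _   = false
    ... | no  v≢x = c (punchOut v≢x)

    c′-punchOut : ∀ {x} (v≢x : v ≢ x) → c′ x ≡ c (punchOut v≢x)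
    c′-punchOut {x} v≢x with v Fin.≟ x
    ... | yes v≡x = ⊥-elim (v≢x v≡x)
    ... | no  _   = cong c (punchOut-cong v refl)

    proper′ : ProperOff X c′ v
    proper′ {x} {y} x≢v y≢v x~y same = proper (punchOut v≢x) (punchOut v≢y) x~y′
                                         (trans (≡.sym (c′-punchOut v≢x)) (trans same (c′-punchOut v≢y)))
      where
        v≢x : v ≢ x
        v≢x = x≢v ∘ ≡.sym
        v≢y : v ≢ y
        v≢y = y≢v ∘ ≡.sym
        x~y′ : adj (delete X v) (punchOut v≢x) (punchOut v≢y) ≡ true
        x~y′ = trans (≡.cong₂ (adj X) (punchIn-punchOut v≢x) (punchIn-punchOut v≢y)) x~y

module WalksIn {N : ℕ} (X : Graph N) where

  infix 4 _~_ _∈ᵥ_ _∉ᵥ_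
  infixr 5 _∷_ _++ʷ_

  _~_ : Fin N → Fin N → Set
  x ~ y = adj X x y ≡ true

  _~?_ : ∀ x y → Dec (x ~ y)
  x ~? y = adj X x y Bool.≟ true

  ~-sym : ∀ {x y} → x ~ y → y ~ x
  ~-sym {x} {y} = trans (sym X y x)

  ~-irrefl : ∀ {x} → ¬ x ~ x
  ~-irrefl {x} x~x = contradiction (trans (≡.sym x~x) (irrefl X x)) λ ()

  data Walk : Fin N → Fin N → Set where
    []  : ∀ {x} → Walk x x
    _∷_ : ∀ {x y z} → x ~ y → Walk y z → Walk x z

  variable
    a b u v x y z : Fin N

  len : Walk x y → ℕ
  len []      = 0
  len (_ ∷ p) = suc (len p)

  _++ʷ_ : Walk x y → Walk y z → Walk x z
  []      ++ʷ q = q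
  (e ∷ p) ++ʷ q = e ∷ (p ++ʷ q)

  len-++ : (p : Walk x y) (q : Walk y z) → len (p ++ʷ q) ≡ len p + len q
  len-++ []      q = refl
  len-++ (_ ∷ p) q = cong suc (len-++ p q)

  len-snoc : (p : Walk x y) (e : y ~ z) → len (p ++ʷ e ∷ []) ≡ suc (len p)
  len-snoc p e = trans (len-++ p (e ∷ [])) (+-comm (len p) 1)

  reverse : Walk x y → Walk y x
  reverse []      = []
  reverse (e ∷ p) = reverse p ++ʷ ~-sym e ∷ []

  len-reverse : (p : Walk x y) → len (reverse p) ≡ len p
  len-reverse []      = refl
  len-reverse (e ∷ p) = trans (len-snoc (reverse p) (~-sym e)) (cong suc (len-reverse p))

  _∈ᵥ_ : Fin N → Walk x y → Set
  v ∈ᵥ [] {x}     = v ≡ x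
  v ∈ᵥ _∷_ {x} _ p = v ≡ x ⊎ v ∈ᵥ p

  _∉ᵥ_ : Fin N → Walk x y → Set
  v ∉ᵥ p = ¬ v ∈ᵥ p

  _∈ᵥ?_ : ∀ v (p : Walk x y) → Dec (v ∈ᵥ p)
  v ∈ᵥ? [] {x}      = v Fin.≟ x
  v ∈ᵥ? _∷_ {x} _ p = v Fin.≟ x ⊎-dec v ∈ᵥ? p

  ∈ᵥ-start : (p : Walk x y) → x ∈ᵥ p
  ∈ᵥ-start []      = refl
  ∈ᵥ-start (_ ∷ _) = inj₁ refl

  ∈ᵥ-++⁺ˡ : {p : Walk x y} (q : Walk y z) → v ∈ᵥ p → v ∈ᵥ p ++ʷ q
  ∈ᵥ-++⁺ˡ {p = []}    q refl       = ∈ᵥ-start q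
  ∈ᵥ-++⁺ˡ {p = _ ∷ _} q (inj₁ v≡x) = inj₁ v≡x
  ∈ᵥ-++⁺ˡ {p = _ ∷ _} q (inj₂ v∈p) = inj₂ (∈ᵥ-++⁺ˡ q v∈p)

  ∈ᵥ-++⁺ʳ : (p : Walk x y) {q : Walk y z} → v ∈ᵥ q → v ∈ᵥ p ++ʷ q
  ∈ᵥ-++⁺ʳ []      v∈q = v∈q
  ∈ᵥ-++⁺ʳ (_ ∷ p) v∈q = inj₂ (∈ᵥ-++⁺ʳ p v∈q)

  ∈ᵥ-++⁻ : (p : Walk x y) {q : Walk y z} → v ∈ᵥ p ++ʷ q → v ∈ᵥ p ⊎ v ∈ᵥ q
  ∈ᵥ-++⁻ []      v∈q        = inj₂ v∈q
  ∈ᵥ-++⁻ (_ ∷ p) (inj₁ v≡x) = inj₁ (inj₁ v≡x)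
  ∈ᵥ-++⁻ (_ ∷ p) (inj₂ v∈)  = map₁ inj₂ (∈ᵥ-++⁻ p v∈)

  split : (p : Walk x y) → v ∈ᵥ p → Σ (Walk x v) λ P → Σ (Walk v y) λ Q → p ≡ P ++ʷ Q
  split []      refl       = [] , [] , refl
  split (e ∷ p) (inj₁ refl) = [] , e ∷ p , refl
  split (e ∷ p) (inj₂ v∈p) with split p v∈p
  ... | P , Q , refl = e ∷ P , Q , refl

  record Rotation (p : Walk x x) (z : Fin N) : Set where
    field
      walk : Walk z z
      len≡ : len walk ≡ len p
      ⊆    : ∀ {v} → v ∈ᵥ walk → v ∈ᵥ p
      ⊇    : ∀ {v} → v ∈ᵥ p → v ∈ᵥ walk

  rotate : (p : Walk x x) → z ∈ᵥ p → Rotation p z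
  rotate p z∈p with split p z∈p
  ... | P , Q , refl = record
    { walk = Q ++ʷ P
    ; len≡ = trans (len-++ Q P) (trans (+-comm (len Q) (len P)) (≡.sym (len-++ P Q)))
    ; ⊆    = [ ∈ᵥ-++⁺ʳ P , ∈ᵥ-++⁺ˡ Q ]′ ∘ ∈ᵥ-++⁻ Q
    ; ⊇    = [ ∈ᵥ-++⁺ʳ Q , ∈ᵥ-++⁺ˡ P ]′ ∘ ∈ᵥ-++⁻ P
    }

  penultimate : Walk x y → Fin N
  penultimate ([] {x})        = x
  penultimate (_∷_ {x} _ [])  = x
  penultimate (_ ∷ e ∷ p)     = penultimate (e ∷ p)

  penultimate-snoc : (p : Walk x y) (e : y ~ z) → penultimate (p ++ʷ e ∷ []) ≡ y
  penultimate-snoc []          e = refl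
  penultimate-snoc (_ ∷ [])    e = refl
  penultimate-snoc (_ ∷ f ∷ p) e = penultimate-snoc (f ∷ p) e

  unsnoc : (p : Walk x y) → 0 < len p →
           Σ (Walk x (penultimate p)) λ q → Σ (penultimate p ~ y) λ e → p ≡ q ++ʷ e ∷ []
  unsnoc (e ∷ [])    _ = [] , e , refl
  unsnoc (e ∷ f ∷ p) _ with unsnoc (f ∷ p) (s≤s z≤n)
  ... | q , e′ , eq = e ∷ q , e′ , cong (e ∷_) eq

  colour-along : ∀ {c} → ProperOff X c u → (p : Walk x y) → u ∉ᵥ p → c y ≡ c x xor odd (len p)
  colour-along {c = c} proper ([] {x}) _ = ≡.sym (xor-identityʳ (c x))
  colour-along {u = u} {c = c} proper (_∷_ {x} {x′} {y} e p) u∉ = begin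
    c y                       ≡⟨ colour-along proper p (u∉ ∘ inj₂) ⟩
    c x′ xor odd (len p)      ≡⟨ cong (_xor odd (len p)) (¬-not colours-differ) ⟩
    not (c x) xor odd (len p) ≡⟨ ≡.sym (not-distribˡ-xor (c x) (odd (len p))) ⟩
    not (c x xor odd (len p)) ≡⟨ not-distribʳ-xor (c x) (odd (len p)) ⟩
    c x xor odd (len (e ∷ p)) ∎
    where
      open ≡.≡-Reasoning
      colours-differ : c x′ ≢ c x
      colours-differ = proper (u∉ ∘ inj₂ ∘ λ x′≡u → subst (_∈ᵥ p) x′≡u (∈ᵥ-start p))
                        (u∉ ∘ inj₁ ∘ ≡.sym) (~-sym e)

  properOff⇒∈ᵥ-odd : ∀ {c} → ProperOff X c u → (p : Walk x x) → odd (len p) ≡ true → u ∈ᵥ p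
  properOff⇒∈ᵥ-odd {u = u} {x = x} {c = c} proper p odd-p with u ∈ᵥ? p
  ... | yes u∈p = u∈p
  ... | no  u∉p = ⊥-elim (not-¬ refl (begin
    c x               ≡⟨ colour-along proper p u∉p ⟩
    c x xor odd (len p) ≡⟨ cong (c x xor_) odd-p ⟩
    c x xor true      ≡⟨ xor-comm (c x) true ⟩
    not (c x)         ∎))
    where open ≡.≡-Reasoning

  record ShortestOdd (C : Walk x x) : Set where
    field
      odd-len  : odd (len C) ≡ true
      shortest : ∀ {z} (p : Walk z z) → odd (len p) ≡ true → len C ≤ len p

  LeastReachable : Fin N → Set
  LeastReachable x = Σ (Fin N) λ r → Walk x r × ∀ {z} → Walk x z → ¬ z Fin.< r

  ¬¬-leastReachable : ∀ x → ¬ ¬ LeastReachable x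
  ¬¬-leastReachable x = ¬¬-minimal <ᶠ-wellFounded {P = Walk x} []

  adjacent⇒same-leastReachable : x ~ y → (rx : LeastReachable x) (ry : LeastReachable y) →
                                 proj₁ rx ≡ proj₁ ry
  adjacent⇒same-leastReachable x~y (r , p , r-min) (s , q , s-min) with Finₚ.<-cmp r s
  ... | tri< r<s _ _ = ⊥-elim (s-min (~-sym x~y ∷ p) r<s)
  ... | tri≈ _ r≡s _ = r≡s
  ... | tri> _ _ s<r = ⊥-elim (r-min (x~y ∷ q) s<r)

  no-odd-closed-walk⇒bipartite : (∀ x → LeastReachable x) → (∀ {z} (p : Walk z z) → odd (len p) ≢ true) →
                                 Bipartite X
  no-odd-closed-walk⇒bipartite least no-odd = colour , proper
    where
      colour : Fin N → Bool
      colour x = odd (len (proj₁ (proj₂ (least x))))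

      proper : ∀ x y → x ~ y → colour x ≢ colour y
      proper x y x~y same with least x | least y | adjacent⇒same-leastReachable x~y (least x) (least y)
      ... | r , p , _ | .r , q , _ | refl = no-odd (p ++ʷ reverse q ++ʷ ~-sym x~y ∷ []) (begin
        odd (len (p ++ʷ reverse q ++ʷ ~-sym x~y ∷ []))     ≡⟨ cong odd (len-++ p _) ⟩
        odd (len p + len (reverse q ++ʷ ~-sym x~y ∷ []))   ≡⟨ cong (odd ∘ (len p +_)) len-back ⟩
        odd (len p + suc (len q))                         ≡⟨ odd-+ (len p) (suc (len q)) ⟩
        odd (len p) xor not (odd (len q))                 ≡⟨ cong (λ b → b xor not (odd (len q))) same ⟩
        odd (len q) xor not (odd (len q))                 ≡⟨ ≡.sym (not-distribʳ-xor (odd (len q)) _) ⟩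
        not (odd (len q) xor odd (len q))                 ≡⟨ cong not (xor-same (odd (len q))) ⟩
        true                                              ∎)
        where
          open ≡.≡-Reasoning
          len-back : len (reverse q ++ʷ ~-sym x~y ∷ []) ≡ suc (len q)
          len-back = trans (len-snoc (reverse q) _) (cong suc (len-reverse q))

  ¬bipartite⇒¬¬shortestOdd : ¬ Bipartite X → ¬ ¬ (∃₂ λ c (C : Walk c c) → ShortestOdd C)
  ¬bipartite⇒¬¬shortestOdd ¬bipartite k =
    ¬¬-∀-Fin ¬¬-leastReachable λ least → ¬bipartite (no-odd-closed-walk⇒bipartite least λ p odd-p →
      ¬¬-minimal (On.wellFounded (len ∘ proj₂) <-wellFounded) {P = OddClosed} {x = _ , p} odd-p
        λ ((c , C) , odd-C , C-min) → k (c , C , record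
          { odd-len  = odd-C
          ; shortest = λ q odd-q → ≮⇒≥ (C-min {z = _ , q} odd-q) }))
    where
      OddClosed : Pred (∃ λ z → Walk z z) _
      OddClosed (_ , p) = odd (len p) ≡ true

  module ShortestOddClosedWalk {c : Fin N} (C : Walk c c) (C-shortest : ShortestOdd C) where

    open ShortestOdd C-shortest public

    k : ℕ
    k = len C

    no-shorter-odd : (p : Walk x x) → odd (len p) ≡ true → ¬ len p < k
    no-shorter-odd p odd-p p<k = <⇒≱ p<k (shortest p odd-p)

    no-shorter-pair : (p : Walk x x) (q : Walk y y) → odd (len p + len q) ≡ true →
                      len p < k → len q < k → ⊥
    no-shorter-pair p q odd-sum p<k q<k with odd-+⇒odd⊎odd (len p) (len q) odd-sum
    ... | inj₁ odd-p = no-shorter-odd p odd-p p<k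
    ... | inj₂ odd-q = no-shorter-odd q odd-q q<k

    no-nonempty-pair-of-total-k : (p : Walk x x) (q : Walk y y) → 0 < len p → 0 < len q →
                                  len p + len q ≡ k → ⊥
    no-nonempty-pair-of-total-k p q p>0 q>0 total = no-shorter-pair p q
      (trans (cong odd total) odd-len)
      (subst (len p <_) total (m<m+n (len p) q>0))
      (subst (len q <_) total (m<n+m (len q) p>0))

    neighbour-is-next-or-previous : (P : Walk y z) (Q : Walk z y) → len P + len Q ≡ k → y ~ z →
                                    len P ≡ 1 ⊎ len Q ≡ 1
    neighbour-is-next-or-previous [] _ _ y~y = ⊥-elim (~-irrefl y~y)
    neighbour-is-next-or-previous (_ ∷ []) _ _ _ = inj₁ refl
    neighbour-is-next-or-previous _ [] _ y~y = ⊥-elim (~-irrefl y~y)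
    neighbour-is-next-or-previous _ (_ ∷ []) _ _ = inj₂ refl
    neighbour-is-next-or-previous P@(_ ∷ _ ∷ _) Q@(_ ∷ _ ∷ _) total y~z = ⊥-elim
      (no-shorter-pair (P ++ʷ ~-sym y~z ∷ []) (y~z ∷ Q)
        (begin
          odd (len (P ++ʷ ~-sym y~z ∷ []) + suc (len Q)) ≡⟨ cong (odd ∘ (_+ suc (len Q))) (len-snoc P _) ⟩
          odd (suc (len P + suc (len Q)))              ≡⟨ cong (odd ∘ suc) (+-suc (len P) (len Q)) ⟩
          odd (2 + (len P + len Q))                    ≡⟨ odd-2+ (len P + len Q) ⟩
          odd (len P + len Q)                          ≡⟨ cong odd total ⟩
          odd k                                        ≡⟨ odd-len ⟩
          true                                         ∎)
        (subst (_< k) (≡.sym (trans (len-snoc P _) (+-comm 1 (len P))))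
               (subst (len P + 1 <_) total (+-monoʳ-< (len P) (s≤s (s≤s z≤n)))))
        (subst (suc (len Q) <_) total (+-monoˡ-< (len Q) (s≤s (s≤s z≤n)))))
      where open ≡.≡-Reasoning

    record NeighboursOn (p : Walk a b) (y : Fin N) : Set where
      field
        left right : Fin N
        y~left     : y ~ left
        y~right    : y ~ right
        left≢right : left ≢ right
        only       : ∀ {z} → z ∈ᵥ p → y ~ z → z ≡ left ⊎ z ≡ right

    neighbours-on-rotation : (R : Walk y y) → len R ≡ k → NeighboursOn R y
    neighbours-on-rotation [] len≡k = contradiction (trans (cong odd len≡k) odd-len) λ ()
    neighbours-on-rotation (e ∷ []) _ = ⊥-elim (~-irrefl e)
    neighbours-on-rotation {y} R@(_∷_ {y = s} e R′@(_ ∷ _)) len≡k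
      with unsnoc R′ (s≤s z≤n)
    ... | q , e′ , R′≡ = record
      { left       = s
      ; right      = penultimate R
      ; y~left     = e
      ; y~right    = ~-sym e′
      ; left≢right = λ s≡t → no-short-closed-arc q s≡t len-R
      ; only       = only
      }
      where
        len-R : 2 + len q ≡ k
        len-R = trans (cong suc (≡.sym (trans (cong len R′≡) (len-snoc q e′)))) len≡k

        no-short-closed-arc : ∀ {s t} (q : Walk s t) → s ≡ t → 2 + len q ≡ k → ⊥
        no-short-closed-arc q refl 2+q≡k = no-shorter-odd q
          (trans (≡.sym (odd-2+ (len q))) (trans (cong odd 2+q≡k) odd-len))
          (subst (len q <_) 2+q≡k (m<n+m (len q) (s≤s z≤n)))

        only : ∀ {z} → z ∈ᵥ R → y ~ z → z ≡ s ⊎ z ≡ penultimate R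
        only z∈R y~z with split R z∈R
        ... | P , Q , R≡PQ with neighbour-is-next-or-previous P Q
                                  (trans (≡.sym (len-++ P Q)) (trans (cong len (≡.sym R≡PQ)) len≡k)) y~z
        only _ _ | _ ∷ [] , _ , refl | inj₁ _ = inj₁ refl
        only _ _ | P , _ ∷ [] , R≡PQ | inj₂ _ =
          inj₂ (≡.sym (trans (cong penultimate R≡PQ) (penultimate-snoc P _)))

    neighbours : y ∈ᵥ C → NeighboursOn C y
    neighbours y∈C = record
      { left = left ; right = right ; y~left = y~left ; y~right = y~right ; left≢right = left≢right
      ; only = only ∘ R.⊇ }
      where
        module R = Rotation (rotate C y∈C)
        open NeighboursOn (neighbours-on-rotation R.walk R.len≡)

    degree≡2 : y ∈ᵥ C → (∀ {u} → y ~ u → u ∈ᵥ C) → degree X y ≡ 2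
    degree≡2 {y} y∈C nbrs∈C = Unique⊆pair⇒length≡2 (filter⁺ (y ~?_) (allFin⁺ N))
      (λ z∈ → only (nbrs∈C (neighbour z∈)) (neighbour z∈))
      (∈-filter⁺ (y ~?_) (∈-allFin left) y~left)
      (∈-filter⁺ (y ~?_) (∈-allFin right) y~right)
      left≢right
      where
        open NeighboursOn (neighbours y∈C)
        neighbour : ∀ {z} → z ∈ filter (y ~?_) (allFin N) → y ~ z
        neighbour = proj₂ ∘ ∈-filter⁻ (y ~?_) {xs = allFin N}

    record TwoApart (a b : Fin N) : Set where
      field
        middle   : Fin N
        middle∈C : middle ∈ᵥ C
        a~middle : a ~ middle
        middle~b : middle ~ b
        rest     : Walk b a
        len-rest : 2 + len rest ≡ k

    TwoApart-sym : TwoApart a b → TwoApart b a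
    TwoApart-sym t = record
      { middle = middle ; middle∈C = middle∈C ; a~middle = ~-sym middle~b ; middle~b = ~-sym a~middle
      ; rest = reverse rest ; len-rest = trans (cong (2 +_) (len-reverse rest)) len-rest }
      where open TwoApart t

    twoApart-from-arcs : x ~ a → x ~ b → a ≢ b → (S : Walk a b) (L : Walk b a) →
                         len S + len L ≡ k → odd (len L) ≡ true → (∀ {v} → v ∈ᵥ S → v ∈ᵥ C) →
                         TwoApart a b
    twoApart-from-arcs _ _ a≢b [] _ _ _ _ = ⊥-elim (a≢b refl)
    twoApart-from-arcs _ _ _ (_ ∷ []) L total odd-L _ =
      contradiction (trans (≡.sym odd-len) (trans (cong odd (≡.sym total)) (cong not odd-L))) λ ()
    twoApart-from-arcs _ _ _ (e₁ ∷ e₂ ∷ []) L total _ S⊆C = record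
      { middle = _ ; middle∈C = S⊆C (inj₂ (inj₁ refl)) ; a~middle = e₁ ; middle~b = e₂
      ; rest = L ; len-rest = total }
    twoApart-from-arcs x~a x~b _ (_ ∷ _ ∷ _ ∷ S) L total odd-L _ = ⊥-elim (
      ≤⇒≯ (m≤n+m (len L) (len S)) (s≤s⁻¹ (s≤s⁻¹
        (subst (_≤ 2 + len L) (≡.sym total)
          (shortest (~-sym x~a ∷ x~b ∷ L) (trans (odd-2+ (len L)) odd-L))))))

    twoApart-from-cut : x ~ a → x ~ b → a ≢ b → (P : Walk a b) (Q : Walk b a) → len P + len Q ≡ k →
                        (∀ {v} → v ∈ᵥ P ++ʷ Q → v ∈ᵥ C) → TwoApart a b
    twoApart-from-cut x~a x~b a≢b P Q total on-C with odd (len Q) in odd-Q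
    ... | true  = twoApart-from-arcs x~a x~b a≢b P Q total odd-Q (on-C ∘ ∈ᵥ-++⁺ˡ Q)
    ... | false = TwoApart-sym (twoApart-from-arcs x~b x~a (a≢b ∘ ≡.sym) Q P
                    (trans (+-comm (len Q) (len P)) total) odd-P (on-C ∘ ∈ᵥ-++⁺ʳ P))
      where
        odd-P : odd (len P) ≡ true
        odd-P with odd-+⇒odd⊎odd (len P) (len Q) (trans (cong odd total) odd-len)
        ... | inj₁ odd-P  = odd-P
        ... | inj₂ odd-Q′ = contradiction (trans (≡.sym odd-Q′) odd-Q) λ ()

    twoApart : x ~ a → x ~ b → a ≢ b → a ∈ᵥ C → b ∈ᵥ C → TwoApart a b
    twoApart x~a x~b a≢b a∈C b∈C
      with record { walk = R ; len≡ = len-R ; ⊆ = R⊆C ; ⊇ = C⊆R } ← rotate C a∈C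
      with P , Q , R≡PQ ← split R (C⊆R b∈C)
      = twoApart-from-cut x~a x~b a≢b P Q
          (trans (≡.sym (len-++ P Q)) (trans (cong len (≡.sym R≡PQ)) len-R))
          (R⊆C ∘ subst (_ ∈ᵥ_) (≡.sym R≡PQ))

    middle-not-deletable : x ∉ᵥ C → x ~ a → x ~ b → (t : TwoApart a b) →
                           ∀ {c} → ¬ ProperOff X c (TwoApart.middle t)
    middle-not-deletable {x} {a} {b} x∉C x~a x~b t proper =
      middle∉detour (properOff⇒∈ᵥ-odd proper detour (trans (cong odd len-rest) odd-len))
      where
        open TwoApart t
        detour : Walk a a
        detour = ~-sym x~a ∷ x~b ∷ rest

        middle∉detour : middle ∉ᵥ detour
        middle∉detour (inj₁ refl)        = ~-irrefl a~middle
        middle∉detour (inj₂ (inj₁ refl)) = x∉C middle∈C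
        middle∉detour (inj₂ (inj₂ m∈rest)) with L₁ , L₂ , refl ← split rest m∈rest =
          no-nonempty-pair-of-total-k (middle~b ∷ L₁) (L₂ ++ʷ a~middle ∷ []) (s≤s z≤n)
            (subst (0 <_) (≡.sym (len-snoc L₂ a~middle)) (s≤s z≤n))
            (begin
              suc (len L₁) + len (L₂ ++ʷ a~middle ∷ []) ≡⟨ cong (suc (len L₁) +_) (len-snoc L₂ a~middle) ⟩
              suc (len L₁) + suc (len L₂)               ≡⟨ cong suc (+-suc (len L₁) (len L₂)) ⟩
              2 + (len L₁ + len L₂)                     ≡⟨ cong (2 +_) (≡.sym (len-++ L₁ L₂)) ⟩
              2 + len rest                              ≡⟨ len-rest ⟩
              k                                         ∎)
          where open ≡.≡-Reasoning

≡-or-swapped : ∀ {a} {A : Set a} {s t a₁ b₁ a₂ b₂ : A} →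
               a₁ ≡ s ⊎ a₁ ≡ t → b₁ ≡ s ⊎ b₁ ≡ t → a₂ ≡ s ⊎ a₂ ≡ t → b₂ ≡ s ⊎ b₂ ≡ t →
               a₁ ≢ b₁ → a₂ ≢ b₂ → a₁ ≡ a₂ ⊎ (a₁ ≡ b₂ × b₁ ≡ a₂)
≡-or-swapped (inj₁ p) (inj₁ q) _        _        a₁≢b₁ _ = ⊥-elim (a₁≢b₁ (trans p (≡.sym q)))
≡-or-swapped (inj₂ p) (inj₂ q) _        _        a₁≢b₁ _ = ⊥-elim (a₁≢b₁ (trans p (≡.sym q)))
≡-or-swapped _        _        (inj₁ p) (inj₁ q) _ a₂≢b₂ = ⊥-elim (a₂≢b₂ (trans p (≡.sym q)))
≡-or-swapped _        _        (inj₂ p) (inj₂ q) _ a₂≢b₂ = ⊥-elim (a₂≢b₂ (trans p (≡.sym q)))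
≡-or-swapped (inj₁ p) _        (inj₁ r) _        _ _ = inj₁ (trans p (≡.sym r))
≡-or-swapped (inj₂ p) _        (inj₂ r) _        _ _ = inj₁ (trans p (≡.sym r))
≡-or-swapped (inj₁ p) (inj₂ q) (inj₂ r) (inj₁ u) _ _ = inj₂ (trans p (≡.sym u) , trans q (≡.sym r))
≡-or-swapped (inj₂ p) (inj₁ q) (inj₁ r) (inj₂ u) _ _ = inj₂ (trans p (≡.sym u) , trans q (≡.sym r))

module Counting {N m : ℕ} (H : Graph N) (w : Fin m → Fin N) (w-injective : Injective _≡_ _≡_ w)
                (w-deletable : ∀ i → Σ (Fin N → Bool) λ c → ProperOff H c (w i))
                {c₀ : Fin N} (C : WalksIn.Walk H c₀ c₀) (C-shortest : WalksIn.ShortestOdd H C) where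

  open WalksIn H
  open ShortestOddClosedWalk C C-shortest

  Bad : Fin m → Set
  Bad i = degree H (w i) ≢ 2

  bad? : Decidable Bad
  bad? i = ¬? (degree H (w i) ≟ 2)

  w∈C : ∀ i → w i ∈ᵥ C
  w∈C i = properOff⇒∈ᵥ-odd (proj₂ (w-deletable i)) C odd-len

  w-<-≢ : ∀ {i j} → j Fin.< i → w i ≢ w j
  w-<-≢ j<i wi≡wj = Finₚ.<-irrefl (≡.sym (w-injective wi≡wj)) j<i

  neighbour-off-C? : ∀ i → Dec (∃ λ u → w i ~ u × u ∉ᵥ C)
  neighbour-off-C? i = any? λ u → w i ~? u ×-dec ¬? (u ∈ᵥ? C)

  -- w i is a junk value for the indices without a neighbour off C.
  outside : Fin m → Fin N
  outside i with neighbour-off-C? i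
  ... | yes (u , _) = u
  ... | no  _       = w i

  outside-spec : ∀ {i} → Bad i → outside i ~ w i × outside i ∉ᵥ C
  outside-spec {i} bad with neighbour-off-C? i
  ... | yes (_ , wi~u , u∉C) = ~-sym wi~u , u∉C
  ... | no  none             = ⊥-elim (bad (degree≡2 (w∈C i) λ wi~u →
                                 decidable-stable (_ ∈ᵥ? C) λ u∉C → none (_ , wi~u , u∉C)))

  Repeated : Fin m → Set
  Repeated i = ∃ λ j → j Fin.< i × Bad j × outside j ≡ outside i

  repeated? : Decidable Repeated
  repeated? i = any? λ j → j Fin.<? i ×-dec bad? j ×-dec outside j Fin.≟ outside i

  outside~earlier : ∀ {i} (r : Repeated i) → outside i ~ w (proj₁ r)
  outside~earlier (j , _ , bad-j , same) = subst (_~ w j) same (proj₁ (outside-spec bad-j))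

  twoApart-of : ∀ {i} → Bad i → (r : Repeated i) → TwoApart (w i) (w (proj₁ r))
  twoApart-of {i} bad r@(_ , j<i , _) =
    twoApart (proj₁ (outside-spec bad)) (outside~earlier r) (w-<-≢ j<i) (w∈C i) (w∈C (proj₁ r))

  φ : Fin m → Fin N
  φ i with bad? i ×-dec repeated? i
  ... | yes (bad , r) = TwoApart.middle (twoApart-of bad r)
  ... | no  _         = outside i

  φ-avoids-w : ∀ {i} → Bad i → ∀ l → φ i ≢ w l
  φ-avoids-w {i} bad l φi≡wl with bad? i ×-dec repeated? i
  ... | no  _ = proj₂ (outside-spec bad) (subst (_∈ᵥ C) (≡.sym φi≡wl) (w∈C l))
  ... | yes (bad′ , r) = middle-not-deletable (proj₂ (outside-spec bad′))
      (proj₁ (outside-spec bad′)) (outside~earlier r) (twoApart-of bad′ r)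
      (subst (ProperOff H (proj₁ (w-deletable l))) (≡.sym φi≡wl) (proj₂ (w-deletable l)))

  same-middle⇒≡ : ∀ {i i′} (bad : Bad i) (r : Repeated i) (bad′ : Bad i′) (r′ : Repeated i′) →
                  TwoApart.middle (twoApart-of bad r) ≡ TwoApart.middle (twoApart-of bad′ r′) → i ≡ i′
  same-middle⇒≡ {i} {i′} bad r@(j , j<i , _) bad′ r′@(j′ , j′<i′ , _) same
    with ≡-or-swapped (only (w∈C i) (~-sym a~middle)) (only (w∈C j) middle~b)
                      (only (w∈C i′) (subst (_~ w i′) (≡.sym same) (~-sym (TwoApart.a~middle t′))))
                      (only (w∈C j′) (subst (_~ w j′) (≡.sym same) (TwoApart.middle~b t′)))
                      (w-<-≢ j<i) (w-<-≢ j′<i′)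
    where
      open TwoApart (twoApart-of bad r)
      t′ : TwoApart (w i′) (w j′)
      t′ = twoApart-of bad′ r′
      open NeighboursOn (neighbours middle∈C)
  ... | inj₁ wi≡wi′         = w-injective wi≡wi′
  ... | inj₂ (wi≡wj′ , wj≡wi′) = ⊥-elim (Finₚ.<-asym
          (subst (Fin._< i) (w-injective wj≡wi′) j<i)
          (subst (Fin._< i′) (≡.sym (w-injective wi≡wj′)) j′<i′))

  φ-injectiveOn : ∀ {i i′} → Bad i → Bad i′ → φ i ≡ φ i′ → i ≡ i′
  φ-injectiveOn {i} {i′} bad bad′ same with bad? i ×-dec repeated? i | bad? i′ ×-dec repeated? i′
  ... | yes (b , r) | yes (b′ , r′) = same-middle⇒≡ b r b′ r′ same
  ... | no  _       | yes (b′ , r′) = ⊥-elim (proj₂ (outside-spec bad)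
                                        (subst (_∈ᵥ C) (≡.sym same) (TwoApart.middle∈C (twoApart-of b′ r′))))
  ... | yes (b , r) | no  _         = ⊥-elim (proj₂ (outside-spec bad′)
                                        (subst (_∈ᵥ C) same (TwoApart.middle∈C (twoApart-of b r))))
  ... | no  ¬r      | no  ¬r′ with Finₚ.<-cmp i i′
  ...   | tri< i<i′ _ _ = ⊥-elim (¬r′ (bad′ , i , i<i′ , bad , same))
  ...   | tri≈ _ i≡i′ _ = i≡i′
  ...   | tri> _ _ i′<i = ⊥-elim (¬r (bad , i′ , i′<i , bad′ , ≡.sym same))

  bad-indices : List (Fin m)
  bad-indices = filter bad? (allFin m)

  m+bad≤N : m + length bad-indices ≤ N
  m+bad≤N = subst (_≤ N) count (Unique⇒length≤ (++⁺ w-distinct φ-distinct disjoint))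
    where
      bad-of : ∀ {i} → i ∈ bad-indices → Bad i
      bad-of = proj₂ ∘ ∈-filter⁻ bad? {xs = allFin m}

      w-distinct : Unique (map w (allFin m))
      w-distinct = map⁺ w-injective (allFin⁺ m)

      φ-distinct : Unique (map φ bad-indices)
      φ-distinct = map⁺-injectiveOn (filter⁺ bad? (allFin⁺ m)) λ i∈ i′∈ →
        φ-injectiveOn (bad-of i∈) (bad-of i′∈)

      disjoint : ∀ {v} → v ∈ map w (allFin m) × v ∈ map φ bad-indices → ⊥
      disjoint (v∈w , v∈φ) with ∈-map⁻ w v∈w | ∈-map⁻ φ v∈φ
      ... | l , _ , v≡wl | i , i∈ , v≡φi = φ-avoids-w (bad-of i∈) l (trans (≡.sym v≡φi) v≡wl)

      count : length (map w (allFin m) ++ map φ bad-indices) ≡ m + length bad-indices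
      count = trans (length-++ (map w (allFin m)))
                    (≡.cong₂ _+_ (trans (length-map w (allFin m)) (length-tabulate _))
                                 (length-map φ bad-indices))

  good+bad≡m : length (filter (λ i → degree H (w i) ≟ 2) (allFin m)) + length bad-indices ≡ m
  good+bad≡m =
    trans (length-filter+length-filter-∁ (λ i → degree H (w i) ≟ 2) (allFin m)) (length-tabulate _)

5n+12≤6m⇒2n+12≤3g : ∀ n m g b → 5 * n + 12 ≤ 6 * m → g + b ≡ m → m + b ≤ n → 2 * n + 12 ≤ 3 * g
5n+12≤6m⇒2n+12≤3g n .(g + b) g b 5n+12≤6m refl g+2b≤n =
  +-cancelʳ-≤ (3 * (g + b + b)) (2 * n + 12) (3 * g) (begin
    2 * n + 12 + 3 * (g + b + b) ≤⟨ +-monoʳ-≤ (2 * n + 12) (*-monoʳ-≤ 3 g+2b≤n) ⟩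
    2 * n + 12 + 3 * n           ≡⟨ solve 1 (λ n → con 2 :* n :+ con 12 :+ con 3 :* n
                                                 := con 5 :* n :+ con 12) refl n ⟩
    5 * n + 12                   ≤⟨ 5n+12≤6m ⟩
    6 * (g + b)                  ≡⟨ solve 2 (λ g b → con 6 :* (g :+ b)
                                                   := con 3 :* g :+ con 3 :* (g :+ b :+ b)) refl g b ⟩
    3 * g + 3 * (g + b + b)      ∎)
  where
    open +-*-Solver
    open ≤-Reasoning

lemma9 : (n : ℕ) → 3 ≤ suc n →
    (G H : Graph (suc n)) → Bipartite G → ¬ Bipartite H →
    (m : ℕ) → 5 * suc n + 12 ≤ 6 * m →
    (v w : Fin m → Fin (suc n)) →
    Injective _≡_ _≡_ v → Injective _≡_ _≡_ w →
    (∀ i → delete G (v i) ≅ delete H (w i)) →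
    2 * suc n + 12 ≤ 3 * length (filter (λ i → degree H (w i) ≟ 2) (allFin m))
lemma9 n _ G H G-bipartite H-not-bipartite m m-large v w _ w-injective G-v≅H-w
  with 2 * suc n + 12 ≤? 3 * length (filter (λ i → degree H (w i) ≟ 2) (allFin m))
... | yes bound = bound
... | no  ¬bound = ⊥-elim (WalksIn.¬bipartite⇒¬¬shortestOdd H H-not-bipartite λ (_ , C , C-shortest) →
      let open Counting H w w-injective H-w-deletable C C-shortest in
      ¬bound (5n+12≤6m⇒2n+12≤3g (suc n) m _ (length bad-indices) m-large good+bad≡m m+bad≤N))
  where
    H-w-deletable : ∀ i → Σ (Fin (suc n) → Bool) λ c → ProperOff H c (w i)
    H-w-deletable i = bipartite-delete⇒properOff {X = H}
      (≅-bipartite {X = delete G (v i)} {Y = delete H (w i)} (G-v≅H-w i)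
        (delete-bipartite {X = G} G-bipartite (v i)))
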